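{- For any node $u \in D$ of the r-suffix trie of $T$, every child $v$ of $u$ is in $D$.
   Context: Let $T$ be a string of length $n$ over an alphabet $\Sigma$. A run of $T$ is a maximal substring $T[i..j]$ consisting of a single repeated character; a position $i$ is a run boundary if some run of $T$ starts at $i$. The r-suffix trie $\mathcal{T}$ of $T$ is the (uncompacted) trie of all suffixes $T[i..n]$ such that $i$ is a run boundary; its nodes correspond one-to-one to the prefixes of these suffixes (including the empty prefix at the root), and a child of a node corresponds to extending its string by one character. For a node $v$, $\mathsf{str}(v)$ is the string spelled by the path from the root to $v$. For a character $c$ and integer $e\ge 0$, $c^e$ denotes $c$ repeated $e$ times. A node $v$ is a matching node for a non-empty string $w$ iff $\mathsf{str}(v) = w[1]^e w$ for some integer $e \ge 0$; the deepest matching node for $w$ is the matching node for $w$ of maximum depth. $D$ denotes the set of nodes that are the deepest matching node for some non-empty string. -}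

module Defs where

open import Data.Nat using (ℕ; zero; suc; _≤_)
open import Data.Fin using (Fin; toℕ)
open import Data.List using (List; []; _∷_; _++_; [_]; length; lookup; drop; replicate)
open import Data.Product using (Σ; ∃; _×_)
open import Data.Sum using (_⊎_)
open import Relation.Binary.PropositionalEquality using (_≡_; _≢_)

module _ {A : Set} (T : List A) where

  RunBoundary : Fin (length T) → Set
  RunBoundary i =
    (toℕ i ≡ 0) ⊎
    (Σ (Fin (length T)) λ j → (suc (toℕ j) ≡ toℕ i) × (lookup T j ≢ lookup T i))

  _IsPrefixOf_ : List A → List A → Set
  s IsPrefixOf l = ∃ λ rest → s ++ rest ≡ l

  -- nodes of the r-suffix trie, identified with their strings str(v):
  -- prefixes of suffixes T[i..] for run boundaries i
  IsNode : List A → Set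
  IsNode s = Σ (Fin (length T)) λ i → RunBoundary i × (s IsPrefixOf drop (toℕ i) T)

  Matching : A → List A → List A → Set
  Matching a w v = IsNode v × (∃ λ e → v ≡ replicate e a ++ (a ∷ w))

  DeepestMatching : A → List A → List A → Set
  DeepestMatching a w v =
    Matching a w v × (∀ v′ → Matching a w v′ → length v′ ≤ length v)

  InD : List A → Set
  InD v = Σ A λ a → Σ (List A) λ w → DeepestMatching a w v

  ChildOf : List A → List A → Set
  ChildOf v u = Σ A λ c → (v ≡ u ++ [ c ]) × IsNode v

-- Appending a character c to both sides of str(u) = a^e a w turns every
-- matching node for a w into one for a w c, and every matching node for a w c
-- has the form p c with p a matching node for a w (nodes are prefix-closed).
-- Hence the deepest matching node for a w, extended by c, is the deepest
-- matching node for a w c.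
module Submission where

open import Defs
open import Data.List using (List; _∷_; _++_; [_]; length; replicate)
open import Data.List.Properties using (++-assoc; length-++)
open import Data.Nat using (_≤_; _+_)
open import Data.Nat.Properties using (+-monoˡ-≤)
open import Data.Product using (Σ-syntax; _×_; _,_)
open import Relation.Binary.Definitions using (DecidableEquality)
open import Relation.Binary.PropositionalEquality
  using (_≡_; refl; sym; trans; subst)

replicate-++-∷-snoc : ∀ {A : Set} e (a : A) w c →
  (replicate e a ++ (a ∷ w)) ++ [ c ] ≡ replicate e a ++ (a ∷ (w ++ [ c ]))
replicate-++-∷-snoc e a w c = ++-assoc (replicate e a) (a ∷ w) [ c ]

length-snoc-mono-≤ : ∀ {A : Set} (p u : List A) c → length p ≤ length u →
                     length (p ++ [ c ]) ≤ length (u ++ [ c ])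
length-snoc-mono-≤ p u c p≤u
  rewrite length-++ p {[ c ]} | length-++ u {[ c ]} = +-monoˡ-≤ 1 p≤u

module _ {A : Set} (T : List A) where

  IsNode-++⁻ˡ : ∀ p {q} → IsNode T (p ++ q) → IsNode T p
  IsNode-++⁻ˡ p {q} (i , boundary , rest , eq) =
    i , boundary , q ++ rest , trans (sym (++-assoc p q rest)) eq

  Matching-snoc⁺ : ∀ {a w u c} → Matching T a w u → IsNode T (u ++ [ c ]) →
                   Matching T a (w ++ [ c ]) (u ++ [ c ])
  Matching-snoc⁺ {a} {w} {c = c} (_ , e , refl) node =
    node , e , replicate-++-∷-snoc e a w c

  Matching-snoc⁻ : ∀ {a w c v} → Matching T a (w ++ [ c ]) v →
                   Σ[ p ∈ List A ] v ≡ p ++ [ c ] × Matching T a w p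
  Matching-snoc⁻ {a} {w} {c} (node , e , refl) =
    p , sym eq , (IsNode-++⁻ˡ p (subst (IsNode T) (sym eq) node) , e , refl)
    where
    p : List A
    p = replicate e a ++ (a ∷ w)
    eq : p ++ [ c ] ≡ replicate e a ++ (a ∷ (w ++ [ c ]))
    eq = replicate-++-∷-snoc e a w c

  DeepestMatching-snoc : ∀ {a w u c} → DeepestMatching T a w u →
                         IsNode T (u ++ [ c ]) →
                         DeepestMatching T a (w ++ [ c ]) (u ++ [ c ])
  DeepestMatching-snoc {a} {w} {u} {c} (match , deepest) node =
    Matching-snoc⁺ match node , bound
    where
    bound : ∀ v′ → Matching T a (w ++ [ c ]) v′ → length v′ ≤ length (u ++ [ c ])
    bound v′ match′ with Matching-snoc⁻ match′
    ... | p , refl , matchₚ = length-snoc-mono-≤ p u c (deepest p matchₚ)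

lemma5 : {A : Set} → DecidableEquality A → (T : List A) →
         (u : List A) → IsNode T u → InD T u →
         (v : List A) → ChildOf T v u → InD T v
lemma5 _ T u _ (a , w , deepest) v (c , refl , node) =
  a , w ++ [ c ] , DeepestMatching-snoc T deepest node
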